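{- Let $T$ be a tournament on strategies $\{1,\dots,n\}$, viewed as a Rock Paper Scissors variant. If $\vec a$ is a Nash equilibrium and $c_j(\vec a)=1$ for all $1\le j\le n$, then $\vec a$ is the only Nash equilibrium.
   Context: A Rock Paper Scissors variant is given by a tournament on strategies $\{1,\dots,n\}$: for distinct $i,j$ exactly one of "$i$ beats $j$" or "$j$ beats $i$" holds. Define $g_{ij}=2$ if $i$ beats $j$, $g_{ii}=1$, and $g_{ij}=0$ if $j$ beats $i$. A strategy profile is a vector $\vec a$ with $a_i\ge 0$ and $\sum_i a_i=1$. A Nash equilibrium is a strategy profile $\vec a$ such that for every strategy profile $\vec b$, $\sum_{i,j} g_{ij}a_ib_j\ge 1$. For a strategy profile $\vec a$, $c_j(\vec a)=\sum_{i=1}^n g_{ij}a_i$. -}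

module Defs where

open import Level using (Level; _⊔_) renaming (suc to lsuc)
open import Data.Nat using (ℕ; zero; suc)
open import Data.Fin using (Fin; zero; suc; _≟_)
open import Data.Bool using (Bool; true; false; not)
open import Relation.Binary.PropositionalEquality using (_≡_)
open import Relation.Binary.Core using (Rel)
open import Relation.Binary.Structures using (IsTotalOrder)
open import Relation.Nullary using (¬_; yes; no)
open import Data.Product using (Σ; _×_; ∃)
open import Algebra.Bundles using (CommutativeRing)

-- The real numbers are an instance; the paper works over ℝ.
record OrderedField (c ℓ₁ ℓ₂ : Level) : Set (lsuc (c ⊔ ℓ₁ ⊔ ℓ₂)) where
  field
    commRing : CommutativeRing c ℓ₁
  open CommutativeRing commRing public
  infix 4 _≤_
  field
    _≤_          : Rel Carrier ℓ₂
    isTotalOrder : IsTotalOrder _≈_ _≤_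
    +-mono-≤     : ∀ {x y} z → x ≤ y → x + z ≤ y + z
    *-nonneg     : ∀ {x y} → 0# ≤ x → 0# ≤ y → 0# ≤ x * y
    0≉1          : ¬ (0# ≈ 1#)
    inverse      : ∀ x → ¬ (x ≈ 0#) → Σ Carrier (λ y → x * y ≈ 1#)

record Tournament (n : ℕ) : Set where
  field
    beats      : Fin n → Fin n → Bool
    tournament : ∀ i j → ¬ (i ≡ j) → beats j i ≡ not (beats i j)

module RPS {c ℓ₁ ℓ₂} (F : OrderedField c ℓ₁ ℓ₂) where
  open OrderedField F using (Carrier; _≈_; _≤_; _+_; _*_; 0#; 1#)

  2# : Carrier
  2# = 1# + 1#

  sumF : ∀ {n} → (Fin n → Carrier) → Carrier
  sumF {zero}  f = 0#
  sumF {suc n} f = f zero + sumF (λ i → f (suc i))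

  g : ∀ {n} → Tournament n → Fin n → Fin n → Carrier
  g T i j with i ≟ j
  ... | yes _ = 1#
  ... | no _ with Tournament.beats T i j
  ...   | true  = 2#
  ...   | false = 0#

  IsProfile : ∀ {n} → (Fin n → Carrier) → Set (ℓ₁ ⊔ ℓ₂)
  IsProfile {n} a = (∀ i → 0# ≤ a i) × (sumF a ≈ 1#)

  payoff : ∀ {n} → Tournament n → (Fin n → Carrier) → (Fin n → Carrier) → Carrier
  payoff T a b = sumF (λ i → sumF (λ j → g T i j * a i * b j))

  IsNash : ∀ {n} → Tournament n → (Fin n → Carrier) → Set (c ⊔ ℓ₁ ⊔ ℓ₂)
  IsNash T a = IsProfile a × (∀ b → IsProfile b → 1# ≤ payoff T a b)

  cc : ∀ {n} → Tournament n → (Fin n → Carrier) → Fin n → Carrier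
  cc T a j = sumF (λ i → g T i j * a i)

-- With G the payoff matrix, c(a) = Gᵀ a. Since g_ij + g_ji = 2, any two profiles satisfy
-- Σ_j a_j c_j(b) + Σ_j b_j c_j(a) = 2, so if c(a) ≡ 1 then Σ_j a_j c_j(b) = 1 for every
-- profile b. A Nash equilibrium b has c_j(b) ≥ 1 (test it against pure strategies), hence
-- c_j(b) = 1 wherever a_j ≠ 0. Everything else rests on one parity fact: an integer matrix
-- congruent to I modulo 2 is nonsingular over any ordered field (its determinant is odd;
-- fraction-free Gaussian elimination preserves the congruence). Gᵀ is such a matrix, and if
-- some a_k were 0 then a would lie in the kernel of another one built from Gᵀ. So a has
-- full support, c(b) = c(a), and b = a.

module Submission where

open import Defs
open import Data.Nat as ℕ using (ℕ; zero; suc)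
open import Data.Fin as Fin using (Fin; zero; suc)
import Data.Nat.Properties as ℕ
open import Data.Integer as ℤ using (ℤ; +_; -[1+_]; _⊖_)
import Data.Integer.Properties as ℤ
open import Data.Maybe using (Maybe; map)
open import Data.Product using (∃; _,_; proj₁; proj₂)
open import Data.Sum using (inj₁; inj₂)
open import Function using (_∘_)
open import Relation.Binary.PropositionalEquality as ≡ using (_≡_; _≢_; cong)
open import Relation.Binary.Consequences using (dec⇒weaklyDec)
open import Relation.Binary.Structures using (IsTotalOrder)
open import Relation.Nullary using (¬_; Dec; yes; no; contradiction)
open import Data.Bool using (true; false; if_then_else_)
open import Algebra.Solver.Ring.AlmostCommutativeRing
  using (_-Raw-AlmostCommutative⟶_; fromCommutativeRing)

module OrderedFieldProperties {c ℓ₁ ℓ₂} (F : OrderedField c ℓ₁ ℓ₂) where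
  open OrderedField F
  open import Algebra.Properties.Group +-group using (⁻¹-involutive)
  open import Algebra.Properties.Ring ring using (-1*x≈-x)
  open import Relation.Binary.Reasoning.Setoid setoid
  module ≤ = IsTotalOrder isTotalOrder

  x≤y⇒0≤y-x : ∀ {x y} → x ≤ y → 0# ≤ y - x
  x≤y⇒0≤y-x {x} {y} x≤y = ≤.≤-respˡ-≈ (-‿inverseʳ x) (+-mono-≤ (- x) x≤y)

  +-nonneg : ∀ {x y} → 0# ≤ x → 0# ≤ y → 0# ≤ x + y
  +-nonneg {x} {y} 0≤x 0≤y = ≤.trans (≤.≤-respʳ-≈ (sym (+-identityˡ y)) 0≤y) (+-mono-≤ y 0≤x)

  +-nonneg-≈0ˡ : ∀ {x y} → 0# ≤ x → 0# ≤ y → x + y ≈ 0# → x ≈ 0#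
  +-nonneg-≈0ˡ {x} {y} 0≤x 0≤y x+y≈0 = ≤.antisym x≤0 0≤x
    where
    x≤0 : x ≤ 0#
    x≤0 = ≤.trans (≤.≤-respˡ-≈ (+-identityˡ x) (≤.≤-respʳ-≈ (+-comm y x) (+-mono-≤ x 0≤y)))
                  (≤.reflexive x+y≈0)

  0≤1 : 0# ≤ 1#
  0≤1 with ≤.total 0# 1#
  ... | inj₁ 0≤1 = 0≤1
  ... | inj₂ 1≤0 = ≤.≤-respʳ-≈ -1*-1≈1 (*-nonneg 0≤-1 0≤-1)
    where
    0≤-1 : 0# ≤ - 1#
    0≤-1 = ≤.≤-respʳ-≈ (+-identityˡ (- 1#)) (x≤y⇒0≤y-x 1≤0)
    -1*-1≈1 : - 1# * - 1# ≈ 1#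
    -1*-1≈1 = trans (-1*x≈-x (- 1#)) (⁻¹-involutive 1#)

  x*y≈0⇒y≈0 : ∀ {x y} → ¬ (x ≈ 0#) → x * y ≈ 0# → y ≈ 0#
  x*y≈0⇒y≈0 {x} {y} x≉0 xy≈0 with inverse x x≉0
  ... | x⁻¹ , x*x⁻¹≈1 = begin
    y                 ≈⟨ *-identityˡ y ⟨
    1# * y            ≈⟨ *-congʳ x*x⁻¹≈1 ⟨
    (x * x⁻¹) * y     ≈⟨ *-congʳ (*-comm x x⁻¹) ⟩
    (x⁻¹ * x) * y     ≈⟨ *-assoc x⁻¹ x y ⟩
    x⁻¹ * (x * y)     ≈⟨ *-congˡ xy≈0 ⟩
    x⁻¹ * 0#          ≈⟨ zeroʳ x⁻¹ ⟩
    0#                ∎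

module IntegerEmbedding {c ℓ₁ ℓ₂} (F : OrderedField c ℓ₁ ℓ₂) where
  open OrderedField F
  open OrderedFieldProperties F
  open import Algebra.Properties.Group +-group using (ε⁻¹≈ε; ⁻¹-involutive; ⁻¹-injective)
  open import Algebra.Properties.AbelianGroup +-abelianGroup using (⁻¹-∙-comm; xyx⁻¹≈y)
  open import Algebra.Properties.Ring ring using (-‿distribˡ-*; -‿distribʳ-*)
  open import Algebra.Properties.Semiring.Mult.TCOptimised semiring using (_×_; 1+×; ×-homo-+; ×1-homo-*)
  open import Relation.Binary.Reasoning.Setoid setoid

  0≤n×1 : ∀ n → 0# ≤ n × 1#
  0≤n×1 zero    = ≤.refl
  0≤n×1 (suc n) = ≤.≤-respʳ-≈ (sym (1+× n 1#)) (+-nonneg 0≤1 (0≤n×1 n))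

  1+n×1≉0 : ∀ n → ¬ (suc n × 1# ≈ 0#)
  1+n×1≉0 n 1+n≈0 = 0≉1 (sym (+-nonneg-≈0ˡ 0≤1 (0≤n×1 n) (trans (sym (1+× n 1#)) 1+n≈0)))

  z+x-[z+y]≈x-y : ∀ z x y → (z + x) - (z + y) ≈ x - y
  z+x-[z+y]≈x-y z x y = begin
    (z + x) - (z + y)      ≈⟨ +-congˡ (⁻¹-∙-comm z y) ⟨
    (z + x) + (- z - y)    ≈⟨ +-assoc (z + x) (- z) (- y) ⟨
    z + x - z - y          ≈⟨ +-congʳ (xyx⁻¹≈y z x) ⟩
    x - y                  ∎

  -- Built on the optimised _×_, for which 1 × x is x itself: the ring solver
  -- below then reads the constant con (+ 1) as 1#.
  fromℤ : ℤ → Carrier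
  fromℤ (+ n)    = n × 1#
  fromℤ -[1+ n ] = - (suc n × 1#)

  fromℤ-neg : ∀ i → fromℤ (ℤ.- i) ≈ - fromℤ i
  fromℤ-neg (+ zero)  = sym ε⁻¹≈ε
  fromℤ-neg (+ suc n) = refl
  fromℤ-neg -[1+ n ]  = sym (⁻¹-involutive _)

  fromℤ-⊖ : ∀ m n → fromℤ (m ⊖ n) ≈ m × 1# - n × 1#
  fromℤ-⊖ zero    zero    = sym (-‿inverseʳ 0#)
  fromℤ-⊖ (suc m) zero    = sym (trans (+-congˡ ε⁻¹≈ε) (+-identityʳ _))
  fromℤ-⊖ zero    (suc n) = sym (+-identityˡ _)
  fromℤ-⊖ (suc m) (suc n) = begin
    fromℤ (suc m ⊖ suc n)            ≡⟨ cong fromℤ (ℤ.[1+m]⊖[1+n]≡m⊖n m n) ⟩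
    fromℤ (m ⊖ n)                    ≈⟨ fromℤ-⊖ m n ⟩
    m × 1# - n × 1#                  ≈⟨ z+x-[z+y]≈x-y 1# (m × 1#) (n × 1#) ⟨
    (1# + m × 1#) - (1# + n × 1#)    ≈⟨ +-cong (1+× m 1#) (-‿cong (1+× n 1#)) ⟨
    suc m × 1# - suc n × 1#          ∎

  fromℤ-+ : ∀ i j → fromℤ (i ℤ.+ j) ≈ fromℤ i + fromℤ j
  fromℤ-+ (+ m)    (+ n)    = ×-homo-+ 1# m n
  fromℤ-+ (+ m)    -[1+ n ] = fromℤ-⊖ m (suc n)
  fromℤ-+ -[1+ m ] (+ n)    = trans (fromℤ-⊖ n (suc m)) (+-comm _ _)
  fromℤ-+ -[1+ m ] -[1+ n ] = begin
    - (suc (suc (m ℕ.+ n)) × 1#)       ≡⟨ cong (λ k → - (suc k × 1#)) (ℕ.+-suc m n) ⟨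
    - ((suc m ℕ.+ suc n) × 1#)         ≈⟨ -‿cong (×-homo-+ 1# (suc m) (suc n)) ⟩
    - (suc m × 1# + suc n × 1#)        ≈⟨ ⁻¹-∙-comm _ _ ⟨
    - (suc m × 1#) + - (suc n × 1#)    ∎

  fromℤ-*-+ : ∀ i n → fromℤ (i ℤ.* + n) ≈ fromℤ i * n × 1#
  fromℤ-*-+ (+ m)    n = trans (reflexive (cong fromℤ (≡.sym (ℤ.pos-* m n)))) (×1-homo-* m n)
  fromℤ-*-+ -[1+ m ] n = begin
    fromℤ (ℤ.- + suc m ℤ.* + n)        ≡⟨ cong fromℤ (ℤ.neg-distribˡ-* (+ suc m) (+ n)) ⟨
    fromℤ (ℤ.- (+ suc m ℤ.* + n))      ≈⟨ fromℤ-neg (+ suc m ℤ.* + n) ⟩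
    - fromℤ (+ suc m ℤ.* + n)          ≈⟨ -‿cong (fromℤ-*-+ (+ suc m) n) ⟩
    - (suc m × 1# * n × 1#)            ≈⟨ -‿distribˡ-* _ _ ⟩
    - (suc m × 1#) * n × 1#            ∎

  fromℤ-* : ∀ i j → fromℤ (i ℤ.* j) ≈ fromℤ i * fromℤ j
  fromℤ-* i (+ n)    = fromℤ-*-+ i n
  fromℤ-* i -[1+ n ] = begin
    fromℤ (i ℤ.* ℤ.- + suc n)          ≡⟨ cong fromℤ (ℤ.neg-distribʳ-* i (+ suc n)) ⟨
    fromℤ (ℤ.- (i ℤ.* + suc n))        ≈⟨ fromℤ-neg (i ℤ.* + suc n) ⟩
    - fromℤ (i ℤ.* + suc n)            ≈⟨ -‿cong (fromℤ-*-+ i (suc n)) ⟩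
    - (fromℤ i * suc n × 1#)           ≈⟨ -‿distribʳ-* _ _ ⟩
    fromℤ i * - (suc n × 1#)           ∎

  fromℤ≈0⇒≡0 : ∀ i → fromℤ i ≈ 0# → i ≡ + 0
  fromℤ≈0⇒≡0 (+ zero)  _   = ≡.refl
  fromℤ≈0⇒≡0 (+ suc n) i≈0 = contradiction i≈0 (1+n×1≉0 n)
  fromℤ≈0⇒≡0 -[1+ n ]  i≈0 = contradiction (⁻¹-injective (trans i≈0 (sym ε⁻¹≈ε))) (1+n×1≉0 n)

  fromℤ-morphism : ℤ.+-*-rawRing -Raw-AlmostCommutative⟶ fromCommutativeRing commRing
  fromℤ-morphism = record
    { ⟦_⟧ = fromℤ ; +-homo = fromℤ-+ ; *-homo = fromℤ-* ; -‿homo = fromℤ-neg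
    ; 0-homo = refl ; 1-homo = refl }

  fromℤ-≟ : ∀ i j → Maybe (fromℤ i ≈ fromℤ j)
  fromℤ-≟ i j = map (λ { ≡.refl → refl }) (dec⇒weaklyDec ℤ._≟_ i j)

  open import Algebra.Solver.Ring ℤ.+-*-rawRing (fromCommutativeRing commRing) fromℤ-morphism fromℤ-≟
    public using (solve; _:=_; _:+_; _:-_; _:*_; con)

module Parity {c ℓ₁ ℓ₂} (F : OrderedField c ℓ₁ ℓ₂) where
  open OrderedField F
  open IntegerEmbedding F
  open RPS F using (2#)
  open import Relation.Binary.Reasoning.Setoid setoid

  IsInt : Carrier → Set ℓ₁
  IsInt x = ∃ λ z → x ≈ fromℤ z

  IsEven : Carrier → Set ℓ₁
  IsEven x = ∃ λ z → x ≈ fromℤ z + fromℤ z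

  IsOdd : Carrier → Set ℓ₁
  IsOdd x = IsEven (x - 1#)

  isInt-resp : ∀ {x y} → x ≈ y → IsInt x → IsInt y
  isInt-resp x≈y (z , x≈z) = z , trans (sym x≈y) x≈z

  isEven-resp : ∀ {x y} → x ≈ y → IsEven x → IsEven y
  isEven-resp x≈y (z , x≈2z) = z , trans (sym x≈y) x≈2z

  isInt-0 : IsInt 0#
  isInt-0 = + 0 , refl

  isInt-1 : IsInt 1#
  isInt-1 = + 1 , refl

  isInt-+ : ∀ {x y} → IsInt x → IsInt y → IsInt (x + y)
  isInt-+ (z , x≈z) (w , y≈w) = z ℤ.+ w , trans (+-cong x≈z y≈w) (sym (fromℤ-+ z w))

  isEven⇒isInt : ∀ {x} → IsEven x → IsInt x
  isEven⇒isInt (z , x≈2z) = z ℤ.+ z , trans x≈2z (sym (fromℤ-+ z z))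

  isEven-0 : IsEven 0#
  isEven-0 = + 0 , sym (+-identityʳ 0#)

  isEven-2 : IsEven 2#
  isEven-2 = + 1 , refl

  isEven-- : ∀ {x y} → IsEven x → IsEven y → IsEven (x - y)
  isEven-- {x} {y} (z , x≈2z) (w , y≈2w) = z ℤ.- w , (begin
    x - y                                    ≈⟨ +-cong x≈2z (-‿cong y≈2w) ⟩
    (fromℤ z + fromℤ z) - (fromℤ w + fromℤ w) ≈⟨ regroup (fromℤ z) (fromℤ w) ⟩
    (fromℤ z - fromℤ w) + (fromℤ z - fromℤ w) ≈⟨ +-cong fromℤ-- fromℤ-- ⟨
    fromℤ (z ℤ.- w) + fromℤ (z ℤ.- w)        ∎)
    where
    fromℤ-- : fromℤ (z ℤ.- w) ≈ fromℤ z - fromℤ w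
    fromℤ-- = trans (fromℤ-+ z (ℤ.- w)) (+-congˡ (fromℤ-neg w))
    regroup : ∀ u v → (u + u) - (v + v) ≈ (u - v) + (u - v)
    regroup = solve 2 (λ u v → (u :+ u) :- (v :+ v) := (u :- v) :+ (u :- v)) refl

  isEven-+ : ∀ {x y} → IsEven x → IsEven y → IsEven (x + y)
  isEven-+ {x} {y} (z , x≈2z) (w , y≈2w) = z ℤ.+ w , (begin
    x + y                                    ≈⟨ +-cong x≈2z y≈2w ⟩
    (fromℤ z + fromℤ z) + (fromℤ w + fromℤ w) ≈⟨ regroup (fromℤ z) (fromℤ w) ⟩
    (fromℤ z + fromℤ w) + (fromℤ z + fromℤ w) ≈⟨ +-cong (fromℤ-+ z w) (fromℤ-+ z w) ⟨
    fromℤ (z ℤ.+ w) + fromℤ (z ℤ.+ w)        ∎)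
    where
    regroup : ∀ u v → (u + u) + (v + v) ≈ (u + v) + (u + v)
    regroup = solve 2 (λ u v → (u :+ u) :+ (v :+ v) := (u :+ v) :+ (u :+ v)) refl

  isEven-*ʳ : ∀ {x y} → IsEven x → IsInt y → IsEven (x * y)
  isEven-*ʳ {x} {y} (z , x≈2z) (w , y≈w) = z ℤ.* w , (begin
    x * y                                    ≈⟨ *-cong x≈2z y≈w ⟩
    (fromℤ z + fromℤ z) * fromℤ w            ≈⟨ distribʳ (fromℤ w) (fromℤ z) (fromℤ z) ⟩
    fromℤ z * fromℤ w + fromℤ z * fromℤ w    ≈⟨ +-cong (fromℤ-* z w) (fromℤ-* z w) ⟨
    fromℤ (z ℤ.* w) + fromℤ (z ℤ.* w)        ∎)

  isEven-*ˡ : ∀ {x y} → IsInt x → IsEven y → IsEven (x * y)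
  isEven-*ˡ {x} {y} x-int y-even = isEven-resp (*-comm y x) (isEven-*ʳ y-even x-int)

  odd≢0 : ∀ z → + 1 ℤ.+ (z ℤ.+ z) ≢ + 0
  odd≢0 (+ n)          ()
  odd≢0 -[1+ zero ]    ()
  odd≢0 -[1+ suc n ]   ()

  isOdd⇒≉0 : ∀ {x} → IsOdd x → ¬ (x ≈ 0#)
  isOdd⇒≉0 {x} (z , x-1≈2z) x≈0 = odd≢0 z (fromℤ≈0⇒≡0 (+ 1 ℤ.+ (z ℤ.+ z)) (begin
    fromℤ (+ 1 ℤ.+ (z ℤ.+ z))             ≈⟨ fromℤ-+ (+ 1) (z ℤ.+ z) ⟩
    1# + fromℤ (z ℤ.+ z)                  ≈⟨ +-congˡ (fromℤ-+ z z) ⟩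
    1# + (fromℤ z + fromℤ z)              ≈⟨ +-congˡ x-1≈2z ⟨
    1# + (x - 1#)                         ≈⟨ 1+[x-1]≈x x ⟩
    x                                     ≈⟨ x≈0 ⟩
    0#                                    ∎))
    where
    1+[x-1]≈x : ∀ x → 1# + (x - 1#) ≈ x
    1+[x-1]≈x = solve 1 (λ x → con (+ 1) :+ (x :- con (+ 1)) := x) refl

module Sums {c ℓ₁ ℓ₂} (F : OrderedField c ℓ₁ ℓ₂) where
  open OrderedField F hiding (zero)
  open OrderedFieldProperties F
  open RPS F using (sumF)
  open import Algebra.Properties.Semiring.Sum semiring
    using (sum; sum-cong-≋; ∑-distrib-+; ∑-comm; *-distribˡ-sum; *-distribʳ-sum; sum-replicate-zero)
  open import Algebra.Properties.Ring ring using (-1*x≈-x)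
  open import Relation.Binary.Reasoning.Setoid setoid

  sumF≡sum : ∀ {n} (f : Fin n → Carrier) → sumF f ≡ sum f
  sumF≡sum {zero}  f = ≡.refl
  sumF≡sum {suc n} f = cong (λ s → f zero + s) (sumF≡sum (f ∘ suc))

  sumF-cong : ∀ {n} {f h : Fin n → Carrier} → (∀ i → f i ≈ h i) → sumF f ≈ sumF h
  sumF-cong {f = f} {h} f≈h rewrite sumF≡sum f | sumF≡sum h = sum-cong-≋ f≈h

  sumF-≈0 : ∀ {n} {f : Fin n → Carrier} → (∀ i → f i ≈ 0#) → sumF f ≈ 0#
  sumF-≈0 {n} {f} f≈0 rewrite sumF≡sum f = trans (sum-cong-≋ f≈0) (sum-replicate-zero n)

  sumF-+ : ∀ {n} (f h : Fin n → Carrier) → sumF (λ i → f i + h i) ≈ sumF f + sumF h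
  sumF-+ f h rewrite sumF≡sum (λ i → f i + h i) | sumF≡sum f | sumF≡sum h = ∑-distrib-+ f h

  sumF-*ˡ : ∀ {n} x (f : Fin n → Carrier) → sumF (λ i → x * f i) ≈ x * sumF f
  sumF-*ˡ x f rewrite sumF≡sum (λ i → x * f i) | sumF≡sum f = sym (*-distribˡ-sum x f)

  sumF-*-sumF : ∀ {m n} (f : Fin m → Carrier) (h : Fin n → Carrier) →
                sumF f * sumF h ≈ sumF (λ j → sumF (λ i → f j * h i))
  sumF-*-sumF f h = begin
    sumF f * sumF h                          ≡⟨ cong (_* sumF h) (sumF≡sum f) ⟩
    sum f * sumF h                           ≈⟨ *-distribʳ-sum (sumF h) f ⟩
    sum (λ j → f j * sumF h)                 ≈⟨ sum-cong-≋ (λ j → sym (sumF-*ˡ (f j) h)) ⟩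
    sum (λ j → sumF (λ i → f j * h i))       ≡⟨ sumF≡sum (λ j → sumF (λ i → f j * h i)) ⟨
    sumF (λ j → sumF (λ i → f j * h i))      ∎

  sumF-comm : ∀ {m n} (f : Fin m → Fin n → Carrier) →
              sumF (λ i → sumF (λ j → f i j)) ≈ sumF (λ j → sumF (λ i → f i j))
  sumF-comm f = begin
    sumF (λ i → sumF (f i))              ≡⟨ sumF≡sum (λ i → sumF (f i)) ⟩
    sum (λ i → sumF (f i))               ≈⟨ sum-cong-≋ (λ i → reflexive (sumF≡sum (f i))) ⟩
    sum (λ i → sum (f i))                ≈⟨ ∑-comm f ⟩
    sum (λ j → sum (λ i → f i j))        ≈⟨ sum-cong-≋ (λ j → reflexive (sumF≡sum (λ i → f i j))) ⟨
    sum (λ j → sumF (λ i → f i j))       ≡⟨ sumF≡sum (λ j → sumF (λ i → f i j)) ⟨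
    sumF (λ j → sumF (λ i → f i j))      ∎

  sumF-neg : ∀ {n} (f : Fin n → Carrier) → sumF (λ i → - f i) ≈ - sumF f
  sumF-neg f = begin
    sumF (λ i → - f i)        ≈⟨ sumF-cong (λ i → -1*x≈-x (f i)) ⟨
    sumF (λ i → - 1# * f i)   ≈⟨ sumF-*ˡ (- 1#) f ⟩
    - 1# * sumF f             ≈⟨ -1*x≈-x (sumF f) ⟩
    - sumF f                  ∎

  sumF-- : ∀ {n} (f h : Fin n → Carrier) → sumF (λ i → f i - h i) ≈ sumF f - sumF h
  sumF-- f h = trans (sumF-+ f (λ i → - h i)) (+-congˡ (sumF-neg h))

  sumF-nonneg : ∀ {n} {f : Fin n → Carrier} → (∀ i → 0# ≤ f i) → 0# ≤ sumF f
  sumF-nonneg {zero}  0≤f = ≤.refl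
  sumF-nonneg {suc n} 0≤f = +-nonneg (0≤f zero) (sumF-nonneg (0≤f ∘ suc))

  sumF-nonneg-≈0 : ∀ {n} {f : Fin n → Carrier} → (∀ i → 0# ≤ f i) → sumF f ≈ 0# → ∀ i → f i ≈ 0#
  sumF-nonneg-≈0 {suc n} 0≤f Σ≈0 zero    = +-nonneg-≈0ˡ (0≤f zero) (sumF-nonneg (0≤f ∘ suc)) Σ≈0
  sumF-nonneg-≈0 {suc n} 0≤f Σ≈0 (suc i) =
    sumF-nonneg-≈0 (0≤f ∘ suc) (+-nonneg-≈0ˡ (sumF-nonneg (0≤f ∘ suc)) (0≤f zero) (trans (+-comm _ _) Σ≈0)) i

module Matrices {c ℓ₁ ℓ₂} (F : OrderedField c ℓ₁ ℓ₂) where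
  open OrderedField F hiding (zero)
  open OrderedFieldProperties F
  open IntegerEmbedding F using (solve; _:=_; _:+_; _:-_; _:*_; con)
  open Parity F
  open Sums F
  open RPS F using (sumF)
  open import Relation.Binary.Reasoning.Setoid setoid

  Matrix : ℕ → Set c
  Matrix m = Fin m → Fin m → Carrier

  _·_ : ∀ {m} → Matrix m → (Fin m → Carrier) → Fin m → Carrier
  (A · x) i = sumF (λ j → A i j * x j)

  δ : ∀ {m} → Fin m → Fin m → Carrier
  δ zero    zero    = 1#
  δ zero    (suc _) = 0#
  δ (suc _) zero    = 0#
  δ (suc i) (suc j) = δ i j

  δ-diag : ∀ {m} (i : Fin m) → δ i i ≡ 1#
  δ-diag zero    = ≡.refl
  δ-diag (suc i) = δ-diag i

  δ-off : ∀ {m} {i j : Fin m} → i ≢ j → δ i j ≡ 0#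
  δ-off {i = zero}  {zero}  i≢j = contradiction ≡.refl i≢j
  δ-off {i = zero}  {suc j} i≢j = ≡.refl
  δ-off {i = suc i} {zero}  i≢j = ≡.refl
  δ-off {i = suc i} {suc j} i≢j = δ-off (i≢j ∘ cong suc)

  δ-isInt : ∀ {m} (i j : Fin m) → IsInt (δ i j)
  δ-isInt zero    zero    = isInt-1
  δ-isInt zero    (suc j) = isInt-0
  δ-isInt (suc i) zero    = isInt-0
  δ-isInt (suc i) (suc j) = δ-isInt i j

  δ-nonneg : ∀ {m} (i j : Fin m) → 0# ≤ δ i j
  δ-nonneg zero    zero    = 0≤1
  δ-nonneg zero    (suc j) = ≤.refl
  δ-nonneg (suc i) zero    = ≤.refl
  δ-nonneg (suc i) (suc j) = δ-nonneg i j

  δ-sum : ∀ {m} (k : Fin m) (f : Fin m → Carrier) → sumF (λ i → f i * δ k i) ≈ f k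
  δ-sum {suc m} zero f = begin
    f zero * 1# + sumF (λ i → f (suc i) * 0#)   ≈⟨ +-cong (*-identityʳ _) (sumF-≈0 (λ i → zeroʳ (f (suc i)))) ⟩
    f zero + 0#                                 ≈⟨ +-identityʳ _ ⟩
    f zero                                      ∎
  δ-sum {suc m} (suc k) f = begin
    f zero * 0# + sumF (λ i → f (suc i) * δ k i) ≈⟨ +-cong (zeroʳ _) (δ-sum k (f ∘ suc)) ⟩
    0# + f (suc k)                               ≈⟨ +-identityˡ _ ⟩
    f (suc k)                                    ∎

  ·-- : ∀ {m} (A : Matrix m) x y i → (A · (λ j → x j - y j)) i ≈ (A · x) i - (A · y) i
  ·-- A x y i = trans (sumF-cong (λ j → x[y-z]≈xy-xz (A i j) (x j) (y j)))
                      (sumF-- (λ j → A i j * x j) (λ j → A i j * y j))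
    where open import Algebra.Properties.Ring ring using (x[y-z]≈xy-xz)

  IsIdentityMod2 : ∀ {m} → Matrix m → Set ℓ₁
  IsIdentityMod2 A = ∀ i j → IsEven (A i j - δ i j)

  identityMod2⇒isInt : ∀ {m} {A : Matrix m} → IsIdentityMod2 A → ∀ i j → IsInt (A i j)
  identityMod2⇒isInt {A = A} A≡I i j =
    isInt-resp (x-y+y≈x (A i j) (δ i j)) (isInt-+ (isEven⇒isInt (A≡I i j)) (δ-isInt i j))
    where
    x-y+y≈x : ∀ x y → x - y + y ≈ x
    x-y+y≈x = solve 2 (λ x y → x :- y :+ y := x) refl

  -- One step of fraction-free Gaussian elimination: it clears the first
  -- column without dividing, so integrality and the residue mod 2 survive.
  eliminate : ∀ {m} → Matrix (suc m) → Matrix m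
  eliminate A i j = A zero zero * A (suc i) (suc j) - A (suc i) zero * A zero (suc j)

  eliminate-identityMod2 : ∀ {m} {A : Matrix (suc m)} → IsIdentityMod2 A → IsIdentityMod2 (eliminate A)
  eliminate-identityMod2 {A = A} A≡I i j =
    isEven-resp (sym (regroup p (A (suc i) (suc j)) q (A zero (suc j)) (δ i j)))
      (isEven-- (isEven-+ (isEven-*ˡ (identityMod2⇒isInt A≡I zero zero) (A≡I (suc i) (suc j)))
                          (isEven-*ʳ p-odd (δ-isInt i j)))
                (isEven-*ʳ q-even (identityMod2⇒isInt A≡I zero (suc j))))
    where
    p q : Carrier
    p = A zero zero
    q = A (suc i) zero
    p-odd : IsOdd p
    p-odd = A≡I zero zero
    x-0≈x : ∀ x → x - 0# ≈ x
    x-0≈x = solve 1 (λ x → x :- con (+ 0) := x) refl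
    q-even : IsEven q
    q-even = isEven-resp (x-0≈x q) (A≡I (suc i) zero)
    regroup : ∀ p e q r d → p * e - q * r - d ≈ p * (e - d) + (p - 1#) * d - q * r
    regroup = solve 5 (λ p e q r d →
      p :* e :- q :* r :- d := p :* (e :- d) :+ (p :- con (+ 1)) :* d :- q :* r) refl

  eliminate-· : ∀ {m} (A : Matrix (suc m)) x i →
    (eliminate A · (x ∘ suc)) i ≈ A zero zero * (A · x) (suc i) - A (suc i) zero * (A · x) zero
  eliminate-· A x i = begin
    sumF (λ j → (p * A (suc i) (suc j) - q * A zero (suc j)) * x (suc j))
      ≈⟨ sumF-cong (λ j → distribute p (A (suc i) (suc j)) q (A zero (suc j)) (x (suc j))) ⟩
    sumF (λ j → p * u j - q * v j)                ≈⟨ sumF-- (λ j → p * u j) (λ j → q * v j) ⟩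
    sumF (λ j → p * u j) - sumF (λ j → q * v j)   ≈⟨ +-cong (sumF-*ˡ p u) (-‿cong (sumF-*ˡ q v)) ⟩
    p * sumF u - q * sumF v                       ≈⟨ cancel p q (x zero) (sumF u) (sumF v) ⟩
    p * (q * x zero + sumF u) - q * (p * x zero + sumF v)
      ∎
    where
    p q : Carrier
    p = A zero zero
    q = A (suc i) zero
    u v : Fin _ → Carrier
    u j = A (suc i) (suc j) * x (suc j)
    v j = A zero (suc j) * x (suc j)
    distribute : ∀ p a q b y → (p * a - q * b) * y ≈ p * (a * y) - q * (b * y)
    distribute = solve 5 (λ p a q b y → (p :* a :- q :* b) :* y := p :* (a :* y) :- q :* (b :* y)) refl
    cancel : ∀ p q y s t → p * s - q * t ≈ p * (q * y + s) - q * (p * y + t)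
    cancel = solve 5 (λ p q y s t → p :* s :- q :* t := p :* (q :* y :+ s) :- q :* (p :* y :+ t)) refl

  identityMod2⇒trivialKernel : ∀ {m} (A : Matrix m) → IsIdentityMod2 A →
    ∀ x → (∀ i → (A · x) i ≈ 0#) → ∀ i → x i ≈ 0#
  identityMod2⇒trivialKernel {zero}  A A≡I x Ax≈0 = λ ()
  identityMod2⇒trivialKernel {suc m} A A≡I x Ax≈0 = λ where
      zero    → x₀≈0
      (suc i) → xₛ≈0 i
    where
    xₛ≈0 : ∀ i → x (suc i) ≈ 0#
    xₛ≈0 = identityMod2⇒trivialKernel (eliminate A) (eliminate-identityMod2 A≡I) (x ∘ suc) λ i → begin
      (eliminate A · (x ∘ suc)) i
        ≈⟨ eliminate-· A x i ⟩
      A zero zero * (A · x) (suc i) - A (suc i) zero * (A · x) zero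
        ≈⟨ +-cong (*-congˡ (Ax≈0 (suc i))) (-‿cong (*-congˡ (Ax≈0 zero))) ⟩
      A zero zero * 0# - A (suc i) zero * 0#
        ≈⟨ p*0-q*0≈0 (A zero zero) (A (suc i) zero) ⟩
      0#
        ∎
      where
      p*0-q*0≈0 : ∀ p q → p * 0# - q * 0# ≈ 0#
      p*0-q*0≈0 = solve 2 (λ p q → p :* con (+ 0) :- q :* con (+ 0) := con (+ 0)) refl
    x₀≈0 : x zero ≈ 0#
    x₀≈0 = x*y≈0⇒y≈0 (isOdd⇒≉0 (A≡I zero zero)) (begin
      A zero zero * x zero        ≈⟨ +-identityʳ _ ⟨
      A zero zero * x zero + 0#   ≈⟨ +-congˡ (sumF-≈0 (λ j → trans (*-congˡ (xₛ≈0 j)) (zeroʳ _))) ⟨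
      (A · x) zero                ≈⟨ Ax≈0 zero ⟩
      0#                          ∎)

  -- Subtracting row k of A - I from every row keeps A ≡ I (mod 2) and turns
  -- A · x into (A · x) j - (A · x) k + x k.
  constantImage∧xₖ≈0⇒x≈0 : ∀ {m} (A : Matrix m) → IsIdentityMod2 A → ∀ x k →
    (∀ j → (A · x) j ≈ (A · x) k) → x k ≈ 0# → ∀ i → x i ≈ 0#
  constantImage∧xₖ≈0⇒x≈0 A A≡I x k Ax≈Axₖ xₖ≈0 = identityMod2⇒trivialKernel B B≡I x Bx≈0
    where
    B : Matrix _
    B j i = A j i - (A k i - δ k i)
    B≡I : IsIdentityMod2 B
    B≡I j i = isEven-resp (regroup (A j i) (δ j i) (A k i) (δ k i)) (isEven-- (A≡I j i) (A≡I k i))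
      where
      regroup : ∀ a d e f → (a - d) - (e - f) ≈ (a - (e - f)) - d
      regroup = solve 4 (λ a d e f → (a :- d) :- (e :- f) := (a :- (e :- f)) :- d) refl
    Bx≈0 : ∀ j → (B · x) j ≈ 0#
    Bx≈0 j = begin
      sumF (λ i → (A j i - (A k i - δ k i)) * x i)
        ≈⟨ sumF-cong (λ i → expand (A j i) (A k i) (δ k i) (x i)) ⟩
      sumF (λ i → A j i * x i - A k i * x i + x i * δ k i)
        ≈⟨ sumF-+ (λ i → A j i * x i - A k i * x i) (λ i → x i * δ k i) ⟩
      sumF (λ i → A j i * x i - A k i * x i) + sumF (λ i → x i * δ k i)
        ≈⟨ +-cong (sumF-- (λ i → A j i * x i) (λ i → A k i * x i)) (δ-sum k x) ⟩
      (A · x) j - (A · x) k + x k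
        ≈⟨ +-cong (+-congʳ (Ax≈Axₖ j)) xₖ≈0 ⟩
      (A · x) k - (A · x) k + 0#
        ≈⟨ trans (+-identityʳ _) (-‿inverseʳ _) ⟩
      0#
        ∎
      where
      expand : ∀ a e d y → (a - (e - d)) * y ≈ a * y - e * y + y * d
      expand = solve 4 (λ a e d y → (a :- (e :- d)) :* y := a :* y :- e :* y :+ y :* d) refl

module Tournaments {c ℓ₁ ℓ₂} (F : OrderedField c ℓ₁ ℓ₂) where
  open OrderedField F hiding (zero)
  open OrderedFieldProperties F
  open IntegerEmbedding F using (solve; _:=_; _:+_; _:-_; _:*_; con)
  open Parity F
  open Sums F
  open Matrices F
  open RPS F
  open import Algebra.Properties.Group +-group using (x∙y⁻¹≈ε⇒x≈y)
  open import Algebra.Properties.Ring ring using (x[y-z]≈xy-xz)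
  open import Relation.Binary.Reasoning.Setoid setoid

  module _ {n} (T : Tournament n) where
    open Tournament T

    g-diag : ∀ i → g T i i ≈ 1#
    g-diag i with i Fin.≟ i
    ... | yes _   = refl
    ... | no i≢i = contradiction ≡.refl i≢i

    g-off-diag : ∀ {i j} → i ≢ j → g T i j ≡ (if beats i j then 2# else 0#)
    g-off-diag {i} {j} i≢j with i Fin.≟ j
    ... | yes i≡j = contradiction i≡j i≢j
    ... | no _ with beats i j
    ...   | true  = ≡.refl
    ...   | false = ≡.refl

    g-isEven : ∀ {i j} → i ≢ j → IsEven (g T i j)
    g-isEven {i} {j} i≢j rewrite g-off-diag i≢j with beats i j
    ... | true  = isEven-2
    ... | false = isEven-0

    g+gᵀ≈2 : ∀ i j → g T i j + g T j i ≈ 2#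
    g+gᵀ≈2 i j = cases (i Fin.≟ j)
      where
      cases : ∀ {i j} → Dec (i ≡ j) → g T i j + g T j i ≈ 2#
      cases {i} (yes ≡.refl) = +-cong (g-diag i) (g-diag i)
      cases {i} {j} (no i≢j)
        rewrite g-off-diag i≢j | g-off-diag (i≢j ∘ ≡.sym) | tournament i j i≢j with beats i j
      ... | true  = +-identityʳ 2#
      ... | false = +-identityˡ 2#

    -- cc T a is Gᵀ · a on the nose.
    Gᵀ : Matrix n
    Gᵀ j i = g T i j

    Gᵀ≡I : IsIdentityMod2 Gᵀ
    Gᵀ≡I j i = cases (i Fin.≟ j)
      where
      cases : ∀ {i j} → Dec (i ≡ j) → IsEven (g T i j - δ j i)
      cases {i} (yes ≡.refl) = isEven-resp (sym g-δ≈0) isEven-0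
        where
        g-δ≈0 : g T i i - δ i i ≈ 0#
        g-δ≈0 = trans (+-cong (g-diag i) (-‿cong (reflexive (δ-diag i)))) (-‿inverseʳ 1#)
      cases (no i≢j) =
        isEven-- (g-isEven i≢j) (isEven-resp (sym (reflexive (δ-off (i≢j ∘ ≡.sym)))) isEven-0)

    δ-isProfile : ∀ (k : Fin n) → IsProfile (δ k)
    δ-isProfile k =
      δ-nonneg k , trans (sumF-cong (λ i → sym (*-identityˡ (δ k i)))) (δ-sum k (λ _ → 1#))

    payoff-δ : ∀ b j → payoff T b (δ j) ≈ cc T b j
    payoff-δ b j = sumF-cong (λ i → δ-sum j (λ j′ → g T i j′ * b i))

    isNash⇒1≤cc : ∀ {b} → IsNash T b → ∀ j → 1# ≤ cc T b j
    isNash⇒1≤cc {b} (_ , 1≤payoff) j = ≤.≤-respʳ-≈ (payoff-δ b j) (1≤payoff (δ j) (δ-isProfile j))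

    cc-duality : ∀ a b →
      sumF (λ j → a j * cc T b j) + sumF (λ j → b j * cc T a j) ≈ 2# * (sumF a * sumF b)
    cc-duality a b = begin
      sumF (λ j → a j * cc T b j) + sumF (λ j → b j * cc T a j)
        ≈⟨ +-cong (sumF-cong (λ j → sym (sumF-*ˡ (a j) (λ i → g T i j * b i))))
                  (sumF-cong (λ j → sym (sumF-*ˡ (b j) (λ i → g T i j * a i)))) ⟩
      sumF (λ j → sumF (λ i → a j * (g T i j * b i))) + sumF (λ j → sumF (λ i → b j * (g T i j * a i)))
        ≈⟨ +-congˡ (sumF-comm (λ j i → b j * (g T i j * a i))) ⟩
      sumF (λ j → sumF (λ i → a j * (g T i j * b i))) + sumF (λ j → sumF (λ i → b i * (g T j i * a j)))
        ≈⟨ sumF-+ (λ j → sumF (λ i → a j * (g T i j * b i))) (λ j → sumF (λ i → b i * (g T j i * a j))) ⟨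
      sumF (λ j → sumF (λ i → a j * (g T i j * b i)) + sumF (λ i → b i * (g T j i * a j)))
        ≈⟨ sumF-cong (λ j → sumF-+ (λ i → a j * (g T i j * b i)) (λ i → b i * (g T j i * a j))) ⟨
      sumF (λ j → sumF (λ i → a j * (g T i j * b i) + b i * (g T j i * a j)))
        ≈⟨ sumF-cong (λ j → sumF-cong (λ i → trans (regroup (a j) (b i) (g T i j) (g T j i))
                                                    (*-congʳ (g+gᵀ≈2 i j)))) ⟩
      sumF (λ j → sumF (λ i → 2# * (a j * b i)))
        ≈⟨ sumF-cong (λ j → sumF-*ˡ 2# (λ i → a j * b i)) ⟩
      sumF (λ j → 2# * sumF (λ i → a j * b i))
        ≈⟨ sumF-*ˡ 2# (λ j → sumF (λ i → a j * b i)) ⟩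
      2# * sumF (λ j → sumF (λ i → a j * b i))
        ≈⟨ *-congˡ (sumF-*-sumF a b) ⟨
      2# * (sumF a * sumF b)
        ∎
      where
      regroup : ∀ x y u v → x * (u * y) + y * (v * x) ≈ (u + v) * (x * y)
      regroup = solve 4 (λ x y u v → x :* (u :* y) :+ y :* (v :* x) := (u :+ v) :* (x :* y)) refl

    IsEqualizer : (Fin n → Carrier) → Set ℓ₁
    IsEqualizer a = ∀ j → cc T a j ≈ 1#

    equalizer⇒≉0 : ∀ {a} → IsProfile a → IsEqualizer a → ∀ k → ¬ (a k ≈ 0#)
    equalizer⇒≉0 {a} (_ , Σa≈1) a-eq k aₖ≈0 = 0≉1 (begin
      0#      ≈⟨ sumF-≈0 a≈0 ⟨
      sumF a  ≈⟨ Σa≈1 ⟩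
      1#      ∎)
      where
      a≈0 : ∀ i → a i ≈ 0#
      a≈0 = constantImage∧xₖ≈0⇒x≈0 Gᵀ Gᵀ≡I a k (λ j → trans (a-eq j) (sym (a-eq k))) aₖ≈0

    equalizer-payoff : ∀ {a b} → IsProfile a → IsEqualizer a → IsProfile b →
                       sumF (λ j → a j * cc T b j) ≈ 1#
    equalizer-payoff {a} {b} (_ , Σa≈1) a-eq (_ , Σb≈1) = begin
      X              ≈⟨ x≈[x+y]-y X Y ⟩
      (X + Y) - Y    ≈⟨ +-cong (trans (cc-duality a b) (*-congˡ (*-cong Σa≈1 Σb≈1))) (-‿cong Y≈1) ⟩
      2# * (1# * 1#) - 1# ≈⟨ 2*[1*1]-1≈1 ⟩
      1#             ∎
      where
      X Y : Carrier
      X = sumF (λ j → a j * cc T b j)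
      Y = sumF (λ j → b j * cc T a j)
      Y≈1 : Y ≈ 1#
      Y≈1 = trans (sumF-cong (λ j → trans (*-congˡ (a-eq j)) (*-identityʳ (b j)))) Σb≈1
      x≈[x+y]-y : ∀ x y → x ≈ (x + y) - y
      x≈[x+y]-y = solve 2 (λ x y → x := (x :+ y) :- y) refl
      2*[1*1]-1≈1 : 2# * (1# * 1#) - 1# ≈ 1#
      2*[1*1]-1≈1 = solve 0 (con (+ 2) :* (con (+ 1) :* con (+ 1)) :- con (+ 1) := con (+ 1)) refl

    equalizer∧nash⇒equalizer : ∀ {a b} → IsProfile a → IsEqualizer a → IsNash T b → IsEqualizer b
    equalizer∧nash⇒equalizer {a} {b} a-prof a-eq b-nash j =
      x∙y⁻¹≈ε⇒x≈y (cc T b j) 1# (x*y≈0⇒y≈0 (equalizer⇒≉0 a-prof a-eq j) (sumF-nonneg-≈0 0≤t Σt≈0 j))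
      where
      0≤t : ∀ j → 0# ≤ a j * (cc T b j - 1#)
      0≤t j = *-nonneg (proj₁ a-prof j) (x≤y⇒0≤y-x (isNash⇒1≤cc b-nash j))
      Σt≈0 : sumF (λ j → a j * (cc T b j - 1#)) ≈ 0#
      Σt≈0 = begin
        sumF (λ j → a j * (cc T b j - 1#))         ≈⟨ sumF-cong (λ j → x[y-z]≈xy-xz (a j) (cc T b j) 1#) ⟩
        sumF (λ j → a j * cc T b j - a j * 1#)     ≈⟨ sumF-- (λ j → a j * cc T b j) (λ j → a j * 1#) ⟩
        sumF (λ j → a j * cc T b j) - sumF (λ j → a j * 1#)
          ≈⟨ +-cong (equalizer-payoff a-prof a-eq (proj₁ b-nash))
                    (-‿cong (trans (sumF-cong (λ j → *-identityʳ (a j))) (proj₂ a-prof))) ⟩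
        1# - 1#                                    ≈⟨ -‿inverseʳ 1# ⟩
        0#                                         ∎

corollary2p5p2 : ∀ {c ℓ₁ ℓ₂} (F : OrderedField c ℓ₁ ℓ₂) (n : ℕ) (T : Tournament n)
    (a : Fin n → OrderedField.Carrier F) →
    RPS.IsNash F T a →
    (∀ j → OrderedField._≈_ F (RPS.cc F T a j) (OrderedField.1# F)) →
    ∀ (b : Fin n → OrderedField.Carrier F) → RPS.IsNash F T b →
    ∀ i → OrderedField._≈_ F (b i) (a i)
corollary2p5p2 F n T a (a-prof , _) a-eq b b-nash i =
  x∙y⁻¹≈ε⇒x≈y (b i) (a i) (identityMod2⇒trivialKernel (Gᵀ T) (Gᵀ≡I T) (λ i → b i - a i) Gᵀ[b-a]≈0 i)
  where
  open OrderedField F hiding (zero)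
  open import Algebra.Properties.Group +-group using (x∙y⁻¹≈ε⇒x≈y)
  open Matrices F
  open Tournaments F
  open RPS F using (cc)
  open import Relation.Binary.Reasoning.Setoid setoid
  Gᵀ[b-a]≈0 : ∀ j → (Gᵀ T · (λ i → b i - a i)) j ≈ 0#
  Gᵀ[b-a]≈0 j = begin
    (Gᵀ T · (λ i → b i - a i)) j   ≈⟨ ·-- (Gᵀ T) b a j ⟩
    cc T b j - cc T a j
      ≈⟨ +-cong (equalizer∧nash⇒equalizer T a-prof a-eq b-nash j) (-‿cong (a-eq j)) ⟩
    1# - 1#                        ≈⟨ -‿inverseʳ 1# ⟩
    0#                             ∎
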